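{- Let $j$ be a positive integer, $D$ a $(2,j)$ digraph, $f$ an acyclic labeling of $D$, $H$ a hole of $P(D)$, $W$ a set extending $H$, and $w$ the vertex with the least $f$-value in $V(H)\cup W$. Then $w\in W$. Moreover, there is a hole $\phi(H)$ of $U(D)$ with $w\in V(\phi(H))$ and $V(\phi(H))\subseteq V(H)\cup W$.
   Context: All digraphs are finite and simple. A $(2,j)$ digraph is an acyclic digraph in which every vertex has indegree at most $2$ and outdegree at most $j$. For an acyclic digraph $D$: $U(D)$ is the simple graph on $V(D)$ with edges $uv$ whenever $(u,v)$ or $(v,u)$ is an arc; $C(D)$ has edges $uv$ ($u\ne v$) whenever $u,v$ have a common out-neighbor; the phylogeny graph $P(D)$ has edge set $E(U(D))\cup E(C(D))$. A hole is an induced cycle of length at least four. An acyclic labeling of a digraph with $n$ vertices is a bijection $f:V(D)\to\{1,\dots,n\}$ with $f(u)>f(v)$ for every arc $(u,v)$. An edge of $P(D)$ is a cared edge if it lies in $C(D)$ but not in $U(D)$; a vertex $v$ takes care of the cared edge $xy$ if $v$ is a common out-neighbor of $x,y$. If $e_1,\dots,e_t$ are the cared edges on the hole $H$ and $w_1,\dots,w_t$ are vertices with $w_k$ taking care of $e_k$ (necessarily distinct), then $W=\{w_1,\dots,w_t\}$ is called a set extending $H$. -}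

module Defs where

open import Data.Nat using (ℕ; zero; suc; _+_; _≤_; _<_; NonZero)
open import Data.Nat.DivMod using (_%_; m%n<n)
open import Data.Fin as F using (Fin; toℕ; fromℕ<)
open import Data.Bool using (Bool; true; false; _∧_; _∨_; not; T)
open import Data.List using (List; length; filterᵇ; allFin)
open import Data.Bool.ListAction using (any)
open import Data.Product using (Σ; ∃; _×_; _,_)
open import Data.Sum using (_⊎_)
open import Relation.Nullary using (¬_; does)
open import Relation.Binary.PropositionalEquality using (_≡_)
open import Function.Definitions using (Injective; Bijective)
open import Function.Bundles using (_⇔_)

record Digraph (n : ℕ) : Set where
  field
    arc      : Fin n → Fin n → Bool
    loopless : ∀ u → arc u u ≡ false
open Digraph public

Graph : ℕ → Set
Graph n = Fin n → Fin n → Bool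

indeg : ∀ {n} → Digraph n → Fin n → ℕ
indeg {n} D u = length (filterᵇ (λ v → arc D v u) (allFin n))

outdeg : ∀ {n} → Digraph n → Fin n → ℕ
outdeg {n} D u = length (filterᵇ (λ v → arc D u v) (allFin n))

-- An acyclic labeling: a bijection f with f(u) > f(v) for every arc (u,v).
-- (Labels are 0..n-1 instead of 1..n; only the order matters.)
record AcyclicLabeling {n} (D : Digraph n) : Set where
  field
    lab     : Fin n → Fin n
    bij     : Bijective _≡_ _≡_ lab
    respect : ∀ u v → T (arc D u v) → toℕ (lab v) < toℕ (lab u)
open AcyclicLabeling public

data Walk {n} (D : Digraph n) : ℕ → Fin n → Fin n → Set where
  here : ∀ {u} → Walk D zero u u
  step : ∀ {k u v w} → T (arc D u v) → Walk D k v w → Walk D (suc k) u w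

Acyclic : ∀ {n} → Digraph n → Set
Acyclic {n} D = ∀ k (u : Fin n) → ¬ Walk D (suc k) u u

Is2j : ∀ {n} → ℕ → Digraph n → Set
Is2j {n} j D = Acyclic D × (∀ (u : Fin n) → indeg D u ≤ 2) × (∀ (u : Fin n) → outdeg D u ≤ j)

UG : ∀ {n} → Digraph n → Graph n
UG D u v = arc D u v ∨ arc D v u

CG : ∀ {n} → Digraph n → Graph n
CG {n} D u v = not (does (u F.≟ v)) ∧ any (λ x → arc D u x ∧ arc D v x) (allFin n)

PG : ∀ {n} → Digraph n → Graph n
PG D u v = UG D u v ∨ CG D u v

next : ∀ {m} → Fin (suc m) → Fin (suc m)
next {m} i = fromℕ< (m%n<n (suc (toℕ i)) (suc m))

CycAdj : ∀ {m} → Fin (suc m) → Fin (suc m) → Set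
CycAdj i j = (j ≡ next i) ⊎ (i ≡ next j)

record Hole {n} (G : Graph n) : Set where
  field
    m       : ℕ
    cyc     : Fin (suc (3 + m)) → Fin n
    cycInj  : Injective _≡_ _≡_ cyc
    induced : ∀ i j → (T (G (cyc i) (cyc j)) ⇔ CycAdj i j)
open Hole public

OnHole : ∀ {n} {G : Graph n} → Hole G → Fin n → Set
OnHole H x = ∃ λ i → cyc H i ≡ x

Cared : ∀ {n} → Digraph n → Fin n → Fin n → Set
Cared D x y = T (CG D x y) × ¬ T (UG D x y)

TakesCare : ∀ {n} → Digraph n → Fin n → Fin n → Fin n → Set
TakesCare D v x y = T (arc D x v) × T (arc D y v)

-- A set extending the hole H of P(D): for each cared edge (index i) of H a vertex w i
-- taking care of it; W = { w i | edge i is cared }.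
record Extending {n} (D : Digraph n) (H : Hole (PG D)) : Set where
  field
    w     : Fin (suc (3 + m H)) → Fin n
    cares : ∀ i → Cared D (cyc H i) (cyc H (next i)) → TakesCare D (w i) (cyc H i) (cyc H (next i))
open Extending public

InW : ∀ {n} {D : Digraph n} {H : Hole (PG D)} → Extending D H → Fin n → Set
InW {D = D} {H} W x = ∃ λ i → Cared D (cyc H i) (cyc H (next i)) × w W i ≡ x

InHW : ∀ {n} {D : Digraph n} {H : Hole (PG D)} → Extending D H → Fin n → Set
InHW {H = H} W x = OnHole H x ⊎ InW W x

module Submission where

-- Arcs strictly decrease the label, so x has no out-neighbour in S.  Hence an edge
-- of H through x cannot be cared (x would have an arc to its carer in W), so both
-- hole-neighbours of x would be in-neighbours of x and, having the common
-- out-neighbour x, would form a chord of H in P(D).  So x ∉ V(H), i.e. x ∈ W: x is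
-- the carer of some cared edge ab of H, and by indegree ≤ 2 its only in-neighbours
-- are a and b.  Walking around H from b back to a, replacing every other cared edge
-- by the two arcs to its carer (which differs from x), gives a walk in U(D) inside
-- S - x; shortcutting it gives an induced path from b to a, with at least three
-- vertices because ab is not an edge of U(D).  Adding x, adjacent on it exactly to
-- a and b, closes this path to the required hole of U(D).

open import Defs
open import Data.Nat using (ℕ; zero; suc; _+_; _∸_; _≤_; _<_; z<s; s<s; s≤s⁻¹; _≤?_)
open import Data.Nat.Properties
  using ( +-identityʳ; +-suc; +-cancelˡ-≡; +-mono-<; <⇒≢; <-irrefl; ≮⇒≥; ≤-antisym; ≤⇒≯; ≰⇒>
        ; m<n+o⇒m∸n<o; m∸n+n≡m; m<m+n; suc-injective; _<?_)
open import Data.Nat.DivMod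
  using (_%_; m<n⇒m%n≡m; n%n≡0; [m+n]%n≡m%n; m%n%n≡m%n; %-distribˡ-+; m≤n⇒[n∸m]%m≡n%m)
open import Data.Bool using (T)
open import Data.Bool.Properties using (T-∨; T-∧; T?)
open import Data.Fin as F using (Fin; toℕ; fromℕ)
open import Data.Fin.Properties using (toℕ-injective; toℕ-fromℕ<; toℕ-fromℕ; toℕ<n; pigeonhole)
  renaming (<⇒≢ to <⇒≢ᶠ)
open import Data.List using (List; []; _∷_; length; lookup; allFin; filterᵇ)
open import Data.List.Membership.Propositional using (_∈_; lose)
open import Data.List.Membership.Propositional.Properties using (∈-lookup; ∈-filter⁺; ∈-allFin)
open import Data.List.Relation.Unary.Any using (Any; here; there; any?; index)
open import Data.List.Relation.Unary.Any.Properties using (lookup-index; any⁺)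
open import Data.List.Relation.Unary.All as All using (All; []; _∷_)
open import Data.List.Relation.Unary.All.Properties using (¬Any⇒All¬)
open import Data.Product using (Σ; _×_; _,_; proj₁; proj₂)
open import Data.Sum as Sum using (_⊎_; inj₁; inj₂)
open import Data.Sum.Function.Propositional using (_⊎-⇔_)
open import Data.Empty using (⊥-elim)
open import Function using (_∘_)
open import Function.Bundles using (Equivalence; _⇔_; mk⇔)
open import Function.Construct.Symmetry using (⇔-sym)
open import Function.Construct.Composition using (_⇔-∘_)
open import Relation.Nullary using (¬_; Dec; yes; no)
open import Relation.Nullary.Decidable using (_⊎-dec_)
open import Relation.Binary.PropositionalEquality
  using (_≡_; _≢_; refl; sym; trans; cong; subst; module ≡-Reasoning)

module _ {N : ℕ} where

  private
    Pos : Set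
    Pos = Fin (suc N)

  next^ : ℕ → Pos → Pos
  next^ zero    i = i
  next^ (suc k) i = next (next^ k i)

  toℕ-next : ∀ (i : Pos) → toℕ (next i) ≡ suc (toℕ i) % suc N
  toℕ-next i = toℕ-fromℕ< _

  suc-% : ∀ r → suc (r % suc N) % suc N ≡ suc r % suc N
  suc-% r = begin
    suc (r % suc N) % suc N                 ≡⟨ %-distribˡ-+ 1 (r % suc N) (suc N) ⟩
    (1 % suc N + r % suc N % suc N) % suc N ≡⟨ cong (λ t → (1 % suc N + t) % suc N)
                                                    (m%n%n≡m%n r (suc N)) ⟩
    (1 % suc N + r % suc N) % suc N         ≡⟨ sym (%-distribˡ-+ 1 r (suc N)) ⟩
    suc r % suc N                           ∎
    where open ≡-Reasoning

  toℕ-next^ : ∀ k (i : Pos) → toℕ (next^ k i) ≡ (toℕ i + k) % suc N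
  toℕ-next^ zero i = sym (trans (cong (_% suc N) (+-identityʳ (toℕ i))) (m<n⇒m%n≡m (toℕ<n i)))
  toℕ-next^ (suc k) i = begin
    toℕ (next (next^ k i))            ≡⟨ toℕ-next (next^ k i) ⟩
    suc (toℕ (next^ k i)) % suc N     ≡⟨ cong (λ r → suc r % suc N) (toℕ-next^ k i) ⟩
    suc ((toℕ i + k) % suc N) % suc N ≡⟨ suc-% (toℕ i + k) ⟩
    suc (toℕ i + k) % suc N           ≡⟨ cong (_% suc N) (sym (+-suc (toℕ i) k)) ⟩
    (toℕ i + suc k) % suc N           ∎
    where open ≡-Reasoning

  next^-full-turn : ∀ (i : Pos) → next^ (suc N) i ≡ i
  next^-full-turn i = toℕ-injective (begin
    toℕ (next^ (suc N) i)    ≡⟨ toℕ-next^ (suc N) i ⟩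
    (toℕ i + suc N) % suc N  ≡⟨ [m+n]%n≡m%n (toℕ i) (suc N) ⟩
    toℕ i % suc N            ≡⟨ m<n⇒m%n≡m (toℕ<n i) ⟩
    toℕ i                    ∎)
    where open ≡-Reasoning

  rotate-≢ : ∀ {i k} → i < suc N → 0 < k → k < suc N → (i + k) % suc N ≢ i
  rotate-≢ {i} {k} i<L 0<k k<L eq with i + k <? suc N
  ... | yes no-wrap = <⇒≢ 0<k (sym (+-cancelˡ-≡ i k 0 (begin
    i + k          ≡⟨ sym (m<n⇒m%n≡m no-wrap) ⟩
    (i + k) % suc N ≡⟨ eq ⟩
    i              ≡⟨ sym (+-identityʳ i) ⟩
    i + 0          ∎)))
    where open ≡-Reasoning
  ... | no wrap = <-irrefl (+-cancelˡ-≡ i k (suc N) (begin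
    i + k                    ≡⟨ sym (m∸n+n≡m L≤i+k) ⟩
    (i + k ∸ suc N) + suc N  ≡⟨ cong (_+ suc N) r≡i ⟩
    i + suc N                ∎)) k<L
    where
    open ≡-Reasoning
    L≤i+k : suc N ≤ i + k
    L≤i+k = ≮⇒≥ wrap
    r≡i : i + k ∸ suc N ≡ i
    r≡i = begin
      i + k ∸ suc N             ≡⟨ sym (m<n⇒m%n≡m (m<n+o⇒m∸n<o (i + k) (suc N) (+-mono-< i<L k<L))) ⟩
      (i + k ∸ suc N) % suc N   ≡⟨ m≤n⇒[n∸m]%m≡n%m L≤i+k ⟩
      (i + k) % suc N           ≡⟨ eq ⟩
      i                         ∎

  next^-moves : ∀ {k} (i : Pos) → 0 < k → k < suc N → next^ k i ≢ i
  next^-moves {k} i 0<k k<L eq =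
    rotate-≢ (toℕ<n i) 0<k k<L (trans (sym (toℕ-next^ k i)) (cong toℕ eq))

  CyclicSucc : Pos → Pos → Set
  CyclicSucc i j = toℕ j ≡ suc (toℕ i) ⊎ (toℕ i ≡ N × toℕ j ≡ 0)

  toℕ-next-inner : ∀ (i : Pos) → toℕ i < N → toℕ (next i) ≡ suc (toℕ i)
  toℕ-next-inner i i<N = trans (toℕ-next i) (m<n⇒m%n≡m (s<s i<N))

  toℕ-next-last : ∀ (i : Pos) → toℕ i ≡ N → toℕ (next i) ≡ 0
  toℕ-next-last i i≡N = trans (toℕ-next i) (trans (cong (λ t → suc t % suc N) i≡N) (n%n≡0 (suc N)))

  next-spec : ∀ (i j : Pos) → (j ≡ next i) ⇔ CyclicSucc i j
  next-spec i j = mk⇔ to from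
    where
    to : j ≡ next i → CyclicSucc i j
    to refl with toℕ i <? N
    ... | yes i<N = inj₁ (toℕ-next-inner i i<N)
    ... | no  i≮N = inj₂ (i≡N , toℕ-next-last i i≡N)
      where i≡N = ≤-antisym (s≤s⁻¹ (toℕ<n i)) (≮⇒≥ i≮N)
    from : CyclicSucc i j → j ≡ next i
    from (inj₁ j≡1+i) = toℕ-injective (trans j≡1+i (sym (toℕ-next-inner i
                          (s≤s⁻¹ (subst (_< suc N) j≡1+i (toℕ<n j))))))
    from (inj₂ (i≡N , j≡0)) = toℕ-injective (trans j≡0 (sym (toℕ-next-last i i≡N)))

  CyclicAdj : Pos → Pos → Set
  CyclicAdj i j = CyclicSucc i j ⊎ CyclicSucc j i

  cycAdj-spec : ∀ (i j : Pos) → CycAdj i j ⇔ CyclicAdj i j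
  cycAdj-spec i j = next-spec i j ⊎-⇔ next-spec j i

module _ {n : ℕ} {G : Graph n} (H : Hole G) where

  hole-step-distinct : ∀ i → cyc H i ≢ cyc H (next i)
  hole-step-distinct i e = next^-moves {k = 1} i z<s (s<s z<s) (sym (cycInj H e))

  -- Vertices two steps apart on a hole are distinct and non-adjacent:
  -- the hole has length at least four, so they are not consecutive.
  hole-gap : ∀ i → cyc H i ≢ cyc H (next (next i)) × ¬ T (G (cyc H i) (cyc H (next (next i))))
  hole-gap i = distinct , non-adjacent
    where
    distinct : cyc H i ≢ cyc H (next (next i))
    distinct e = next^-moves {k = 2} i z<s (s<s (s<s z<s)) (sym (cycInj H e))
    non-adjacent : ¬ T (G (cyc H i) (cyc H (next (next i))))
    non-adjacent adj with Equivalence.to (induced H i (next (next i))) adj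
    ... | inj₁ e = next^-moves {k = 1} (next i) z<s (s<s z<s) e
    ... | inj₂ e = next^-moves {k = 3} i z<s (s<s (s<s (s<s z<s))) (sym e)

module InducedPaths {n : ℕ} (G : Graph n)
  (G-sym : ∀ {u v} → T (G u v) → T (G v u))
  (G-irrefl : ∀ {u} → ¬ T (G u u)) where

  Touches : Fin n → Fin n → Set
  Touches v y = v ≡ y ⊎ T (G v y)

  touches? : ∀ v y → Dec (Touches v y)
  touches? v y = (v F.≟ y) ⊎-dec T? (G v y)

  data WalkIn (P : Fin n → Set) (t : Fin n) : Fin n → Set where
    arrive : P t → WalkIn P t t
    hop    : ∀ {v u} → P v → T (G v u) → WalkIn P t u → WalkIn P t v

  data InducedPath (t : Fin n) : Fin n → List (Fin n) → Set where
    trivial : InducedPath t t []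
    extend  : ∀ {v u rs} → T (G v u) → All (¬_ ∘ Touches v) rs →
              InducedPath t u rs → InducedPath t v (u ∷ rs)

  PathIn : (Fin n → Set) → Fin n → Fin n → Set
  PathIn P t v = Σ (List (Fin n)) λ rs → InducedPath t v rs × All P (v ∷ rs)

  -- Prepending a vertex v that touches an induced path: cut the path at the last
  -- vertex that v touches.
  prepend : ∀ {P t u rs v} → P v → InducedPath t u rs → All P (u ∷ rs) →
            Any (Touches v) (u ∷ rs) → PathIn P t v
  prepend pv trivial ps (here (inj₁ refl)) = [] , trivial , ps
  prepend pv trivial ps (here (inj₂ vu))   = _ ∷ [] , extend vu [] trivial , pv ∷ ps
  prepend {v = v} pv (extend {u = u′} {rs = rs′} uu′ far path) (pu ∷ ps) touch
    with any? (touches? v) (u′ ∷ rs′)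
  ... | yes later = prepend pv path ps later
  ... | no  none with touch
  ...   | there later      = ⊥-elim (none later)
  ...   | here (inj₁ refl) = _ , extend uu′ far path , pu ∷ ps
  ...   | here (inj₂ vu)   = _ , extend vu (¬Any⇒All¬ _ none) (extend uu′ far path) , pv ∷ pu ∷ ps

  shortcut : ∀ {P t v} → WalkIn P t v → PathIn P t v
  shortcut (arrive pt) = [] , trivial , pt ∷ []
  shortcut (hop pv vu walk) with shortcut walk
  ... | rs , path , ps = prepend pv path ps (here (inj₂ vu))

  path-nil : ∀ {t v} → InducedPath t v [] → v ≡ t
  path-nil trivial = refl

  path-single : ∀ {t v u} → InducedPath t v (u ∷ []) → T (G v t)
  path-single (extend vu _ trivial) = vu

  far-at : ∀ {v rs} → All (¬_ ∘ Touches v) rs → ∀ j → ¬ Touches v (lookup rs j)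
  far-at far j = All.lookup far (∈-lookup j)

  path-injective : ∀ {t v rs} → InducedPath t v rs →
                   ∀ i j → lookup (v ∷ rs) i ≡ lookup (v ∷ rs) j → i ≡ j
  path-injective _ F.zero F.zero _ = refl
  path-injective (extend vu _ _) F.zero (F.suc F.zero) refl = ⊥-elim (G-irrefl vu)
  path-injective (extend vu _ _) (F.suc F.zero) F.zero refl = ⊥-elim (G-irrefl vu)
  path-injective (extend _ far _) F.zero (F.suc (F.suc j)) e = ⊥-elim (far-at far j (inj₁ e))
  path-injective (extend _ far _) (F.suc (F.suc i)) F.zero e = ⊥-elim (far-at far i (inj₁ (sym e)))
  path-injective (extend _ _ path) (F.suc i) (F.suc j) e = cong F.suc (path-injective path i j e)

  path-end : ∀ {t v rs} → InducedPath t v rs → lookup (v ∷ rs) (fromℕ (length rs)) ≡ t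
  path-end trivial = refl
  path-end (extend _ _ path) = path-end path

  Consecutive : ∀ {k} → Fin k → Fin k → Set
  Consecutive i j = toℕ j ≡ suc (toℕ i) ⊎ toℕ i ≡ suc (toℕ j)

  path-adjacency : ∀ {t v rs} → InducedPath t v rs → ∀ i j →
                   T (G (lookup (v ∷ rs) i) (lookup (v ∷ rs) j)) ⇔ Consecutive i j
  path-adjacency _ F.zero F.zero = mk⇔ (⊥-elim ∘ G-irrefl) λ { (inj₁ ()) ; (inj₂ ()) }
  path-adjacency (extend vu _ _) F.zero (F.suc F.zero) = mk⇔ (λ _ → inj₁ refl) (λ _ → vu)
  path-adjacency (extend vu _ _) (F.suc F.zero) F.zero = mk⇔ (λ _ → inj₂ refl) (λ _ → G-sym vu)
  path-adjacency (extend _ far _) F.zero (F.suc (F.suc j)) =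
    mk⇔ (λ adj → ⊥-elim (far-at far j (inj₂ adj))) λ { (inj₁ ()) ; (inj₂ ()) }
  path-adjacency (extend _ far _) (F.suc (F.suc i)) F.zero =
    mk⇔ (λ adj → ⊥-elim (far-at far i (inj₂ (G-sym adj)))) λ { (inj₁ ()) ; (inj₂ ()) }
  path-adjacency (extend _ _ path) (F.suc i) (F.suc j) = shift ⇔-∘ path-adjacency path i j
    where
    shift : Consecutive i j ⇔ Consecutive (F.suc i) (F.suc j)
    shift = mk⇔ (λ { (inj₁ e) → inj₁ (cong suc e) ; (inj₂ e) → inj₂ (cong suc e) })
                (λ { (inj₁ e) → inj₁ (suc-injective e) ; (inj₂ e) → inj₂ (suc-injective e) })

  adjacency-sym : ∀ {u v} → T (G u v) ⇔ T (G v u)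
  adjacency-sym = mk⇔ G-sym G-sym

  module Cone {x a b r₁ r₂ : Fin n} {rs : List (Fin n)}
    (path : InducedPath a b (r₁ ∷ r₂ ∷ rs))
    (x-off : All (x ≢_) (b ∷ r₁ ∷ r₂ ∷ rs))
    (x-b : T (G x b)) (x-a : T (G x a))
    (x-only-ends : ∀ {y} → y ∈ (b ∷ r₁ ∷ r₂ ∷ rs) → T (G x y) → y ≡ a ⊎ y ≡ b) where

    vertices : List (Fin n)
    vertices = b ∷ r₁ ∷ r₂ ∷ rs

    cone-cyc : Fin (suc (3 + length rs)) → Fin n
    cone-cyc F.zero    = x
    cone-cyc (F.suc i) = lookup vertices i

    cone-injective : ∀ {i j} → cone-cyc i ≡ cone-cyc j → i ≡ j
    cone-injective {F.zero}  {F.zero}  _ = refl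
    cone-injective {F.zero}  {F.suc j} e = ⊥-elim (All.lookup x-off (∈-lookup j) e)
    cone-injective {F.suc i} {F.zero}  e = ⊥-elim (All.lookup x-off (∈-lookup i) (sym e))
    cone-injective {F.suc i} {F.suc j} e = cong F.suc (path-injective path i j e)

    last : Fin (length vertices)
    last = fromℕ (2 + length rs)

    at-last : ∀ j → toℕ j ≡ 2 + length rs → j ≡ last
    at-last j e = toℕ-injective (trans e (sym (toℕ-fromℕ _)))

    apex-adjacency : ∀ j → T (G x (lookup vertices j)) ⇔ CyclicAdj F.zero (F.suc j)
    apex-adjacency j = mk⇔ to from
      where
      to : T (G x (lookup vertices j)) → CyclicAdj F.zero (F.suc j)
      to adj with x-only-ends (∈-lookup j) adj
      ... | inj₂ e with path-injective path j F.zero e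
      ...   | refl = inj₁ (inj₁ refl)
      to adj | inj₁ e with path-injective path j last (trans e (sym (path-end path)))
      ...   | refl = inj₂ (inj₂ (cong suc (toℕ-fromℕ _) , refl))
      from : CyclicAdj F.zero (F.suc j) → T (G x (lookup vertices j))
      from (inj₁ (inj₁ e)) with toℕ-injective {i = j} {j = F.zero} (suc-injective e)
      ... | refl = x-b
      from (inj₁ (inj₂ (() , _)))
      from (inj₂ (inj₁ ()))
      from (inj₂ (inj₂ (e , _))) with at-last j (suc-injective e)
      ... | refl = subst (λ y → T (G x y)) (sym (path-end path)) x-a

    rim-adjacency : ∀ i j → Consecutive i j ⇔ CyclicAdj {3 + length rs} (F.suc i) (F.suc j)
    rim-adjacency i j = mk⇔
      (λ { (inj₁ e) → inj₁ (inj₁ (cong suc e)) ; (inj₂ e) → inj₂ (inj₁ (cong suc e)) })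
      (λ { (inj₁ (inj₁ e)) → inj₁ (suc-injective e) ; (inj₁ (inj₂ (_ , ())))
         ; (inj₂ (inj₁ e)) → inj₂ (suc-injective e) ; (inj₂ (inj₂ (_ , ()))) })

    cone-adjacency : ∀ i j → T (G (cone-cyc i) (cone-cyc j)) ⇔ CyclicAdj i j
    cone-adjacency F.zero F.zero = mk⇔ (⊥-elim ∘ G-irrefl)
      λ { (inj₁ (inj₁ ())) ; (inj₁ (inj₂ (() , _))) ; (inj₂ (inj₁ ())) ; (inj₂ (inj₂ (() , _))) }
    cone-adjacency F.zero (F.suc j) = apex-adjacency j
    cone-adjacency (F.suc i) F.zero =
      (mk⇔ Sum.swap Sum.swap ⇔-∘ apex-adjacency i) ⇔-∘ adjacency-sym
    cone-adjacency (F.suc i) (F.suc j) = rim-adjacency i j ⇔-∘ path-adjacency path i j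

    hole : Hole G
    hole = record
      { m       = length rs
      ; cyc     = cone-cyc
      ; cycInj  = cone-injective
      ; induced = λ i j → ⇔-sym (cycAdj-spec i j) ⇔-∘ cone-adjacency i j
      }

    hole-vertices : ∀ {y} → OnHole hole y → y ≡ x ⊎ y ∈ vertices
    hole-vertices (F.zero  , refl) = inj₁ refl
    hole-vertices (F.suc i , refl) = inj₂ (∈-lookup i)

injection-length : ∀ {A : Set} {k} (g : Fin k → A) (xs : List A) →
                   (∀ {i j} → g i ≡ g j → i ≡ j) → (∀ i → g i ∈ xs) → k ≤ length xs
injection-length {k = k} g xs g-inj g∈xs with k ≤? length xs
... | yes k≤len = k≤len
... | no  k≰len with pigeonhole (≰⇒> k≰len) (λ i → index (g∈xs i))
... | i , j , i<j , same-index = ⊥-elim (<⇒≢ᶠ i<j (g-inj (begin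
  g i                            ≡⟨ lookup-index (g∈xs i) ⟩
  lookup xs (index (g∈xs i))     ≡⟨ cong (lookup xs) same-index ⟩
  lookup xs (index (g∈xs j))     ≡⟨ sym (lookup-index (g∈xs j)) ⟩
  g j                            ∎)))
  where open ≡-Reasoning

module _ {n : ℕ} (D : Digraph n) where

  arc⇒UG : ∀ {u v} → T (arc D u v) → T (UG D u v)
  arc⇒UG uv = Equivalence.from T-∨ (inj₁ uv)

  reverse-arc⇒UG : ∀ {u v} → T (arc D v u) → T (UG D u v)
  reverse-arc⇒UG {u} {v} vu = Equivalence.from (T-∨ {arc D u v}) (inj₂ vu)

  UG-sym : ∀ {u v} → T (UG D u v) → T (UG D v u)
  UG-sym {u} {v} t with Equivalence.to (T-∨ {arc D u v}) t
  ... | inj₁ uv = reverse-arc⇒UG uv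
  ... | inj₂ vu = arc⇒UG vu

  UG-irrefl : ∀ {u} → ¬ T (UG D u u)
  UG-irrefl {u} t rewrite loopless D u = t

  common-out-neighbour⇒PG : ∀ {u v z} → u ≢ v → T (arc D u z) → T (arc D v z) → T (PG D u v)
  common-out-neighbour⇒PG {u} {v} {z} u≢v uz vz = Equivalence.from (T-∨ {UG D u v}) (inj₂ in-CG)
    where
    in-CG : T (CG D u v)
    in-CG with u F.≟ v
    ... | yes u≡v = ⊥-elim (u≢v u≡v)
    ... | no  _   = any⁺ _ (lose (∈-allFin z) (Equivalence.from T-∧ (uz , vz)))

  triple : Fin n → Fin n → Fin n → Fin 3 → Fin n
  triple a b c F.zero                    = a
  triple a b c (F.suc F.zero)            = b
  triple a b c (F.suc (F.suc F.zero))    = c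

  only-two-in-neighbours : ∀ {x a b y} → indeg D x ≤ 2 → a ≢ b →
    T (arc D a x) → T (arc D b x) → T (arc D y x) → y ≡ a ⊎ y ≡ b
  only-two-in-neighbours {x} {a} {b} {y} indeg≤2 a≢b ax bx yx with y F.≟ a | y F.≟ b
  ... | yes y≡a | _       = inj₁ y≡a
  ... | no  _   | yes y≡b = inj₂ y≡b
  ... | no  y≢a | no  y≢b = ⊥-elim (≤⇒≯ indeg≤2 (injection-length (triple a b y) _ distinct in-list))
    where
    distinct : ∀ {i j} → triple a b y i ≡ triple a b y j → i ≡ j
    distinct {F.zero}                 {F.zero}                 _ = refl
    distinct {F.suc F.zero}           {F.suc F.zero}           _ = refl
    distinct {F.suc (F.suc F.zero)}   {F.suc (F.suc F.zero)}   _ = refl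
    distinct {F.zero}                 {F.suc F.zero}           e = ⊥-elim (a≢b e)
    distinct {F.suc F.zero}           {F.zero}                 e = ⊥-elim (a≢b (sym e))
    distinct {F.zero}                 {F.suc (F.suc F.zero)}   e = ⊥-elim (y≢a (sym e))
    distinct {F.suc (F.suc F.zero)}   {F.zero}                 e = ⊥-elim (y≢a e)
    distinct {F.suc F.zero}           {F.suc (F.suc F.zero)}   e = ⊥-elim (y≢b (sym e))
    distinct {F.suc (F.suc F.zero)}   {F.suc F.zero}           e = ⊥-elim (y≢b e)
    in-neighbour : ∀ {v} → T (arc D v x) → v ∈ filterᵇ (λ u → arc D u x) (allFin n)
    in-neighbour {v} vx = ∈-filter⁺ (λ u → T? (arc D u x)) (∈-allFin v) vx
    in-list : ∀ i → triple a b y i ∈ filterᵇ (λ u → arc D u x) (allFin n)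
    in-list F.zero                 = in-neighbour ax
    in-list (F.suc F.zero)         = in-neighbour bx
    in-list (F.suc (F.suc F.zero)) = in-neighbour yx

module LeastVertex {n : ℕ} (D : Digraph n) (f : AcyclicLabeling D) (H : Hole (PG D))
  (W : Extending D H) (x : Fin n)
  (x-least : ∀ y → InHW W y → toℕ (lab f x) ≤ toℕ (lab f y)) where

  S : Fin n → Set
  S = InHW W

  on-hole : ∀ i → S (cyc H i)
  on-hole i = inj₁ (i , refl)

  carer-in-S : ∀ i → Cared D (cyc H i) (cyc H (next i)) → S (w W i)
  carer-in-S i c = inj₂ (i , c , refl)

  -- Arcs decrease the label, so x has no out-neighbour in S ...
  no-arc-out : ∀ {y} → S y → ¬ T (arc D x y)
  no-arc-out {y} y∈S xy = ≤⇒≯ (x-least y y∈S) (respect f x y xy)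

  in-arc : ∀ {y} → S y → T (UG D y x) → T (arc D y x)
  in-arc {y} y∈S yx with Equivalence.to (T-∨ {arc D y x}) yx
  ... | inj₁ y→x = y→x
  ... | inj₂ x→y = ⊥-elim (no-arc-out y∈S x→y)

  edge-kind : ∀ i → T (UG D (cyc H i) (cyc H (next i))) ⊎ Cared D (cyc H i) (cyc H (next i))
  edge-kind i with T? (UG D (cyc H i) (cyc H (next i)))
  ... | yes in-U = inj₁ in-U
  ... | no  not-U with Equivalence.to (T-∨ {UG D (cyc H i) (cyc H (next i))})
                         (Equivalence.from (induced H i (next i)) (inj₁ refl))
  ...   | inj₁ in-U = ⊥-elim (not-U in-U)
  ...   | inj₂ in-C = inj₂ (in-C , not-U)

  -- An edge of H through x is not cared: x would have an arc to its carer, which is in S.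
  uncared-at-x : ∀ i → cyc H i ≡ x ⊎ cyc H (next i) ≡ x → T (UG D (cyc H i) (cyc H (next i)))
  uncared-at-x i x-on-edge with edge-kind i
  ... | inj₁ in-U = in-U
  ... | inj₂ c with cares W i c | x-on-edge
  ...   | (i→w , _) | inj₁ refl = ⊥-elim (no-arc-out (carer-in-S i c) i→w)
  ...   | (_ , j→w) | inj₂ refl = ⊥-elim (no-arc-out (carer-in-S i c) j→w)

  pred-arc : ∀ i → cyc H (next i) ≡ x → T (arc D (cyc H i) x)
  pred-arc i refl = in-arc (on-hole i) (uncared-at-x i (inj₂ refl))

  succ-arc : ∀ i → cyc H i ≡ x → T (arc D (cyc H (next i)) x)
  succ-arc i refl = in-arc (on-hole (next i)) (UG-sym D (uncared-at-x i (inj₁ refl)))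

  -- x is not on H: its two hole-neighbours would have the common out-neighbour x,
  -- giving a chord of H in P(D).
  x-off-hole : ¬ OnHole H x
  x-off-hole (i , cyc-i≡x) with next^ (3 + m H) i | next^-full-turn i
  ... | p | refl with hole-gap H p
  ...   | distinct , no-chord =
          no-chord (common-out-neighbour⇒PG D distinct
                     (pred-arc p cyc-i≡x) (succ-arc (next p) cyc-i≡x))

  x-in-W : S x → InW W x
  x-in-W (inj₁ on-H) = ⊥-elim (x-off-hole on-H)
  x-in-W (inj₂ in-W) = in-W

  module AsCarer (indeg≤2 : indeg D x ≤ 2) (k : Fin (suc (3 + m H)))
    (cared-k : Cared D (cyc H k) (cyc H (next k))) (w-k≡x : w W k ≡ x) where

    open InducedPaths (UG D) (UG-sym D) (UG-irrefl D)

    a b : Fin n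
    a = cyc H k
    b = cyc H (next k)

    x∈S : S x
    x∈S = subst S w-k≡x (carer-in-S k cared-k)

    a→x : T (arc D a x)
    a→x = subst (λ z → T (arc D a z)) w-k≡x (proj₁ (cares W k cared-k))

    b→x : T (arc D b x)
    b→x = subst (λ z → T (arc D b z)) w-k≡x (proj₂ (cares W k cared-k))

    in-neighbour-of-x : ∀ {y} → T (arc D y x) → y ≡ a ⊎ y ≡ b
    in-neighbour-of-x = only-two-in-neighbours D indeg≤2 (hole-step-distinct H k) a→x b→x

    -- The carer of any other cared edge of H differs from x: otherwise both ends of
    -- that edge would be among a, b.
    other-carer : ∀ i → i ≢ k → (c : Cared D (cyc H i) (cyc H (next i))) → x ≢ w W i
    other-carer i i≢k c x≡w with cares W i c
    ... | i→w , j→w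
      with in-neighbour-of-x (subst (λ z → T (arc D (cyc H i) z)) (sym x≡w) i→w)
         | in-neighbour-of-x (subst (λ z → T (arc D (cyc H (next i)) z)) (sym x≡w) j→w)
    ... | inj₁ i-at-a | _ = i≢k (cycInj H i-at-a)
    ... | inj₂ i-at-b | j-at with cycInj H i-at-b
    ...   | refl with j-at
    ...     | inj₁ j-at-a = next^-moves {k = 2} k z<s (s<s (s<s z<s)) (cycInj H j-at-a)
    ...     | inj₂ j-at-b = next^-moves {k = 1} (next k) z<s (s<s z<s) (cycInj H j-at-b)

    Avoid : Fin n → Set
    Avoid y = S y × x ≢ y

    on-hole-avoids : ∀ i → Avoid (cyc H i)
    on-hole-avoids i = on-hole i , λ x≡cyc → x-off-hole (i , sym x≡cyc)

    walk-edge : ∀ i → i ≢ k → WalkIn Avoid a (cyc H (next i)) → WalkIn Avoid a (cyc H i)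
    walk-edge i i≢k rest with edge-kind i
    ... | inj₁ in-U = hop (on-hole-avoids i) in-U rest
    ... | inj₂ c with cares W i c
    ...   | i→w , j→w = hop (on-hole-avoids i) (arc⇒UG D i→w)
                          (hop (carer-in-S i c , other-carer i i≢k c) (reverse-arc⇒UG D j→w) rest)

    -- Going around H from position k + 1 + s back to k, with d = N - s edges left.
    around : ∀ d s → s + d ≡ 3 + m H → WalkIn Avoid a (cyc H (next^ (suc s) k))
    around zero s s+0≡N =
      subst (λ i → WalkIn Avoid a (cyc H i)) (sym back-at-k) (arrive (on-hole-avoids k))
      where
      back-at-k : next^ (suc s) k ≡ k
      back-at-k = trans (cong (λ t → next^ (suc t) k) (trans (sym (+-identityʳ s)) s+0≡N))
                        (next^-full-turn k)
    around (suc d) s s+d+1≡N =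
      walk-edge (next^ (suc s) k) not-back (around d (suc s) (trans (sym (+-suc s d)) s+d+1≡N))
      where
      not-back : next^ (suc s) k ≢ k
      not-back = next^-moves k z<s (s<s (subst (s <_) s+d+1≡N (m<m+n s z<s)))

    b-to-a : WalkIn Avoid a b
    b-to-a = around (3 + m H) 0 refl

    -- Shortcutting b-to-a yields an induced path from b to a in S - x; it has at least
    -- three vertices as a ≠ b are non-adjacent in U(D), and x closes it to a hole.
    hole-through-x : Σ (Hole (UG D)) (λ φ → OnHole φ x × (∀ y → OnHole φ y → InHW W y))
    hole-through-x with shortcut b-to-a
    ... | [] , path , _ = ⊥-elim (hole-step-distinct H k (sym (path-nil path)))
    ... | _ ∷ [] , path , _ = ⊥-elim (proj₂ cared-k (UG-sym D (path-single path)))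
    ... | r₁ ∷ r₂ ∷ rs , path , avoids = Closed.hole , (F.zero , refl) , in-S
      where
      x-only-ends : ∀ {y} → y ∈ (b ∷ r₁ ∷ r₂ ∷ rs) → T (UG D x y) → y ≡ a ⊎ y ≡ b
      x-only-ends y∈ x-y =
        in-neighbour-of-x (in-arc (proj₁ (All.lookup avoids y∈)) (UG-sym D x-y))
      module Closed = Cone path (All.map proj₂ avoids)
                        (reverse-arc⇒UG D b→x) (reverse-arc⇒UG D a→x) x-only-ends
      in-S : ∀ y → OnHole Closed.hole y → S y
      in-S y on-φ with Closed.hole-vertices on-φ
      ... | inj₁ refl = x∈S
      ... | inj₂ y∈   = proj₁ (All.lookup avoids y∈)

lemma3p4 : (j : ℕ) → 1 ≤ j → {n : ℕ} → (D : Digraph n) → Is2j j D →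
    (f : AcyclicLabeling D) → (H : Hole (PG D)) → (W : Extending D H) →
    (x : Fin n) → InHW W x → (∀ y → InHW W y → toℕ (lab f x) ≤ toℕ (lab f y)) →
    InW W x × Σ (Hole (UG D)) (λ φ → OnHole φ x × (∀ y → OnHole φ y → InHW W y))
lemma3p4 j _ D (_ , indeg≤2 , _) f H W x x∈S x-least =
  let open LeastVertex D f H W x x-least
      (k , cared-k , w-k≡x) = x-in-W x∈S
  in  (k , cared-k , w-k≡x) , AsCarer.hole-through-x (indeg≤2 x) k cared-k w-k≡x
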